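{- Let $F$ be a formula in CNF that does not contain the equality predicate, and let $C \in F$ be a clause that is blocked in $F$ (i.e., blocked by some literal $L \in C$). Let $F'$ be a finite set of ground instances of clauses in $F \setminus \{C\}$ and let $F_C$ be a finite set of ground instances of $C$. Then every propositional assignment that satisfies $F'$ can be turned (by changing truth values of ground atoms) into a propositional assignment that satisfies $F' \cup F_C$; in particular, if $F'$ is propositionally satisfiable then so is $F' \cup F_C$.
   Context: First-order logic. A literal is an atom or a negated atom; for a literal $L$, $\bar L$ denotes its complement. A clause is a disjunction of literals, treated as a multiset of literals; a formula in CNF is a finite set of clauses; variables of clauses are implicitly universally quantified, and distinct clauses are assumed to be variable disjoint. A ground instance of an expression $E$ is $E\sigma$ for a substitution $\sigma$ such that $E\sigma$ contains no variables. A propositional assignment maps ground atoms to $\{0,1\}$ and evaluates ground clauses with the usual semantics; a set of ground clauses is propositionally satisfiable if some propositional assignment satisfies all of them. A clause is valid if it is true in every interpretation (in the absence of equality, iff it contains a pair of complementary literals). $L$-resolvent: given clauses $C = L \lor C'$ and $D = N_1 \lor \dots \lor N_l \lor D'$ with $l > 0$ (variable disjoint) such that $L, \bar N_1, \dots, \bar N_l$ are unifiable with most general unifier $\sigma$, the clause $C'\sigma \lor D'\sigma$ is an $L$-resolvent of $C$ and $D$. A clause $C$ is blocked by a literal $L \in C$ in a formula $F$ if every $L$-resolvent of $C$ with a clause in $F \setminus \{C\}$ is valid; $C$ is blocked in $F$ if it is blocked by some literal of $C$. -}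

module Defs where

open import Data.Nat using (ℕ)
open import Data.Bool using (Bool; true; false; not)
open import Data.List using (List; []; _∷_; _++_; map)
open import Data.List.Membership.Propositional using (_∈_)
open import Data.List.Relation.Unary.All using (All)
open import Data.List.Relation.Binary.Permutation.Propositional using (_↭_)
open import Data.Product using (Σ; ∃; _×_; _,_)
open import Data.Empty using (⊥)
open import Data.Sum using (_⊎_)
open import Relation.Nullary using (¬_)
open import Relation.Binary.PropositionalEquality using (_≡_)

data Term : Set where
  var : ℕ → Term
  fun : ℕ → List Term → Term

record Atom : Set where
  constructor atom
  field
    pred : ℕ
    args : List Term

-- A literal: sign (true = positive) together with an atom.
record Literal : Set where
  constructor lit
  field
    sign : Bool
    atm  : Atom

compl : Literal → Literal
compl (lit s a) = lit (not s) a

-- A clause is a multiset of literals (a list up to permutation _↭_).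
Clause : Set
Clause = List Literal

Formula : Set
Formula = List Clause

Subst : Set
Subst = ℕ → Term

mutual
  substT : Subst → Term → Term
  substT σ (var x)    = σ x
  substT σ (fun f ts) = fun f (substTs σ ts)

  substTs : Subst → List Term → List Term
  substTs σ []       = []
  substTs σ (t ∷ ts) = substT σ t ∷ substTs σ ts

substA : Subst → Atom → Atom
substA σ (atom p ts) = atom p (substTs σ ts)

substL : Subst → Literal → Literal
substL σ (lit s a) = lit s (substA σ a)

substC : Subst → Clause → Clause
substC σ = map (substL σ)

mutual
  _occursT_ : ℕ → Term → Set
  x occursT var y    = x ≡ y
  x occursT fun f ts = x occursTs ts

  _occursTs_ : ℕ → List Term → Set
  x occursTs []       = ⊥
  x occursTs (t ∷ ts) = (x occursT t) ⊎ (x occursTs ts)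

_occursC_ : ℕ → Clause → Set
x occursC C = Σ Literal λ K → K ∈ C × (x occursTs Atom.args (Literal.atm K))

GroundClause : Clause → Set
GroundClause C = ∀ x → ¬ (x occursC C)

VarDisjoint : Clause → Clause → Set
VarDisjoint C D = ∀ x → x occursC C → ¬ (x occursC D)

-- Validity (no equality: iff it contains complementary literals)

Valid : Clause → Set
Valid C = Σ Literal λ K → K ∈ C × compl K ∈ C

Unifies : Subst → Literal → List Literal → Set
Unifies σ L Ns = All (λ N → substL σ (compl N) ≡ substL σ L) Ns

IsMGU : Subst → Literal → List Literal → Set
IsMGU σ L Ns =
  Unifies σ L Ns ×
  (∀ θ → Unifies θ L Ns → Σ Subst λ τ → ∀ x → θ x ≡ substT τ (σ x))

data IsLResolvent (L : Literal) (C D R : Clause) : Set where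
  resolvent : (C' Ns D' : Clause) (N : Literal) (σ : Subst) →
    VarDisjoint C D →
    C ↭ (L ∷ C') →
    D ↭ ((N ∷ Ns) ++ D') →
    IsMGU σ L (N ∷ Ns) →
    R ≡ substC σ C' ++ substC σ D' →
    IsLResolvent L C D R

_∈_∖_ : Clause → Formula → Clause → Set
D ∈ F ∖ C = D ∈ F × ¬ (D ↭ C)

BlockedBy : Literal → Clause → Formula → Set
BlockedBy L C F =
  L ∈ C × (∀ D → D ∈ F ∖ C → ∀ R → IsLResolvent L C D R → Valid R)

Blocked : Clause → Formula → Set
Blocked C F = Σ Literal λ L → BlockedBy L C F

-- distinct clauses of F are variable disjoint (standing assumption)
PairwiseVarDisjoint : Formula → Set
PairwiseVarDisjoint F =
  ∀ C D → C ∈ F → D ∈ F → ¬ (C ↭ D) → VarDisjoint C D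

GroundInstanceOf : Clause → Clause → Set
GroundInstanceOf G C = Σ Subst λ σ → G ≡ substC σ C × GroundClause G

-- Propositional assignments (values on non-ground atoms are irrelevant)

Assignment : Set
Assignment = Atom → Bool

SatLit : Assignment → Literal → Set
SatLit I (lit s a) = I a ≡ s

SatClause : Assignment → Clause → Set
SatClause I C = Σ Literal λ K → K ∈ C × SatLit I K

SatSet : Assignment → List Clause → Set
SatSet I S = All (SatClause I) S

PropSatisfiable : List Clause → Set
PropSatisfiable S = Σ Assignment λ I → SatSet I S

-- Suppose I satisfies the ground instances F' of F ∖ {C} but falsifies some
-- instance Cσ. Flipping the atom of Lσ repairs Cσ without breaking F': a
-- ground instance Dτ that loses its only true literal must contain the
-- complement of Lσ, so the ground resolution of Cσ with Dτ on Lσ lifts to an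
-- L-resolvent R of C and D whose instance under some υ collects literals of
-- Cσ and of Dτ that were all false under I. R is valid because C is blocked,
-- yet no assignment falsifies an instance of a valid clause. Every flip makes
-- one more instance of L true and none false, so after finitely many flips
-- all of F_C is satisfied.
module Submission where

open import Defs
open import Data.Bool using (Bool; true; false)
import Data.Bool.Properties as Bool
open import Data.Empty using (⊥-elim)
open import Data.List using (List; []; _∷_; _++_; map; filter; length)
open import Data.List.Membership.Propositional using (_∈_; find; lose; mapWith∈)
open import Data.List.Membership.Propositional.Properties
  using (∈-filter⁺; ∈-filter⁻; ∈-++⁺ˡ; ∈-++⁺ʳ; ∈-++⁻; ∈-map⁺; ∈-map⁻; ∈-∃++)
open import Data.List.Properties using (∷-injective; filter-notAll; map-++; map-∘; map-cong; partition-defn)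
open import Data.List.Relation.Binary.Permutation.Propositional
  using (_↭_; ↭-sym; ↭-trans; prep; ↭ₛ⇒↭)
open import Data.List.Relation.Binary.Permutation.Propositional.Properties
  using (shift; ∈-resp-↭)
import Data.List.Relation.Binary.Permutation.Setoid.Properties as Permutationₛ
open import Data.List.Relation.Unary.All using (All; []; _∷_; all?; tabulate; lookup)
open import Data.List.Relation.Unary.All.Properties using (¬All⇒Any¬; ++⁺)
open import Data.List.Relation.Unary.Any using (here; there; any?)
open import Data.List.Relation.Unary.Any.Properties using (mapWith∈⁺)
open import Data.Nat using (ℕ; zero; suc; _+_; _≤_; _<_; s≤s⁻¹)
open import Data.Nat.Induction using (<-wellFounded)
open import Data.Nat.Properties
  using (≤-refl; ≤-trans; <-≤-trans; m≤m+n; m≤n+m; m≤n⇒m≤1+n; n≤1+n; +-comm; +-assoc; +-monoʳ-≤; 1+n≰n; n≮0)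
import Data.Nat.Properties as ℕ
open import Data.Product using (Σ; ∃; _×_; _,_; proj₁; proj₂)
open import Data.Sum using (_⊎_; inj₁; inj₂; [_,_]′)
open import Function using (_∘_)
open import Function.Bundles using (_⇔_; mk⇔; Equivalence)
import Function.Properties.Equivalence as ⇔
open import Induction.WellFounded using (Acc; acc)
open import Relation.Binary.PropositionalEquality
  using (_≡_; _≢_; _≗_; refl; sym; trans; cong; cong₂; subst; setoid; module ≡-Reasoning)
open import Relation.Nullary using (¬_; Dec; yes; no; ¬?; contradiction)
open import Relation.Nullary.Decidable using (map′; _×-dec_; _⊎-dec_; decidable-stable)
open import Relation.Unary using (Decidable)
open import Relation.Unary.Properties using (∁?)

open Equivalence using (to; from)

infixr 9 _∘ˢ_

_∘ˢ_ : Subst → Subst → Subst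
(θ ∘ˢ σ) x = substT θ (σ x)

mutual
  substT-var : ∀ t → substT var t ≡ t
  substT-var (var x)    = refl
  substT-var (fun f ts) = cong (fun f) (substTs-var ts)

  substTs-var : ∀ ts → substTs var ts ≡ ts
  substTs-var []       = refl
  substTs-var (t ∷ ts) = cong₂ _∷_ (substT-var t) (substTs-var ts)

mutual
  substT-∘ˢ : ∀ θ σ t → substT θ (substT σ t) ≡ substT (θ ∘ˢ σ) t
  substT-∘ˢ θ σ (var x)    = refl
  substT-∘ˢ θ σ (fun f ts) = cong (fun f) (substTs-∘ˢ θ σ ts)

  substTs-∘ˢ : ∀ θ σ ts → substTs θ (substTs σ ts) ≡ substTs (θ ∘ˢ σ) ts
  substTs-∘ˢ θ σ []       = refl
  substTs-∘ˢ θ σ (t ∷ ts) = cong₂ _∷_ (substT-∘ˢ θ σ t) (substTs-∘ˢ θ σ ts)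

mutual
  substT-cong : ∀ {σ θ} t → (∀ x → x occursT t → σ x ≡ θ x) → substT σ t ≡ substT θ t
  substT-cong (var x)    σ≡θ = σ≡θ x refl
  substT-cong (fun f ts) σ≡θ = cong (fun f) (substTs-cong ts σ≡θ)

  substTs-cong : ∀ {σ θ} ts → (∀ x → x occursTs ts → σ x ≡ θ x) → substTs σ ts ≡ substTs θ ts
  substTs-cong []       σ≡θ = refl
  substTs-cong (t ∷ ts) σ≡θ =
    cong₂ _∷_ (substT-cong t (λ x → σ≡θ x ∘ inj₁)) (substTs-cong ts (λ x → σ≡θ x ∘ inj₂))

substT-≗ : ∀ {σ θ} → σ ≗ θ → ∀ t → substT σ t ≡ substT θ t
substT-≗ σ≗θ t = substT-cong t (λ x _ → σ≗θ x)

substTs-≗ : ∀ {σ θ} → σ ≗ θ → ∀ ts → substTs σ ts ≡ substTs θ ts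
substTs-≗ σ≗θ ts = substTs-cong ts (λ x _ → σ≗θ x)

substTs-++ : ∀ σ ts us → substTs σ (ts ++ us) ≡ substTs σ ts ++ substTs σ us
substTs-++ σ []       us = refl
substTs-++ σ (t ∷ ts) us = cong (substT σ t ∷_) (substTs-++ σ ts us)

length-substTs : ∀ σ ts → length (substTs σ ts) ≡ length ts
length-substTs σ []       = refl
length-substTs σ (t ∷ ts) = cong suc (length-substTs σ ts)

mutual
  occursT-substT : ∀ σ {y} t → y occursT substT σ t → ∃ λ z → z occursT t × y occursT σ z
  occursT-substT σ (var x)    o = x , refl , o
  occursT-substT σ (fun f ts) o = occursTs-substTs σ ts o

  occursTs-substTs : ∀ σ {y} ts → y occursTs substTs σ ts → ∃ λ z → z occursTs ts × y occursT σ z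
  occursTs-substTs σ (t ∷ ts) (inj₁ o) with occursT-substT σ t o
  ... | z , z∈t , y∈σz = z , inj₁ z∈t , y∈σz
  occursTs-substTs σ (t ∷ ts) (inj₂ o) with occursTs-substTs σ ts o
  ... | z , z∈ts , y∈σz = z , inj₂ z∈ts , y∈σz

occursTs-++ : ∀ {y} ts us → y occursTs (ts ++ us) → y occursTs ts ⊎ y occursTs us
occursTs-++ []       us o        = inj₂ o
occursTs-++ (t ∷ ts) us (inj₁ o) = inj₁ (inj₁ o)
occursTs-++ (t ∷ ts) us (inj₂ o) with occursTs-++ ts us o
... | inj₁ o′ = inj₁ (inj₂ o′)
... | inj₂ o′ = inj₂ o′

mutual
  varsT : Term → List ℕ
  varsT (var x)    = x ∷ []
  varsT (fun f ts) = varsTs ts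

  varsTs : List Term → List ℕ
  varsTs []       = []
  varsTs (t ∷ ts) = varsT t ++ varsTs ts

mutual
  occursT⇒∈varsT : ∀ {y} t → y occursT t → y ∈ varsT t
  occursT⇒∈varsT (var x)    refl = here refl
  occursT⇒∈varsT (fun f ts) o    = occursTs⇒∈varsTs ts o

  occursTs⇒∈varsTs : ∀ {y} ts → y occursTs ts → y ∈ varsTs ts
  occursTs⇒∈varsTs (t ∷ ts) (inj₁ o) = ∈-++⁺ˡ (occursT⇒∈varsT t o)
  occursTs⇒∈varsTs (t ∷ ts) (inj₂ o) = ∈-++⁺ʳ (varsT t) (occursTs⇒∈varsTs ts o)

mutual
  size : Term → ℕ
  size (var x)    = 1
  size (fun f ts) = suc (sizes ts)

  sizes : List Term → ℕ
  sizes []       = 0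
  sizes (t ∷ ts) = size t + sizes ts

sizes-++ : ∀ ts us → sizes (ts ++ us) ≡ sizes ts + sizes us
sizes-++ []       us = refl
sizes-++ (t ∷ ts) us = trans (cong (size t +_) (sizes-++ ts us)) (sym (+-assoc (size t) _ _))

mutual
  size-occursT : ∀ θ {x} t → x occursT t → size (θ x) ≤ size (substT θ t)
  size-occursT θ (var y)    refl = ≤-refl
  size-occursT θ (fun f ts) o    = m≤n⇒m≤1+n (size-occursTs θ ts o)

  size-occursTs : ∀ θ {x} ts → x occursTs ts → size (θ x) ≤ sizes (substTs θ ts)
  size-occursTs θ (t ∷ ts) (inj₁ o) = ≤-trans (size-occursT θ t o) (m≤m+n _ _)
  size-occursTs θ (t ∷ ts) (inj₂ o) = ≤-trans (size-occursTs θ ts o) (m≤n+m _ _)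

occurs-check : ∀ θ {x f ts} → x occursTs ts → θ x ≢ substT θ (fun f ts)
occurs-check θ {ts = ts} o θx≡ = 1+n≰n (subst (λ t → size t ≤ sizes (substTs θ ts)) θx≡ (size-occursTs θ ts o))

mutual
  _≟ᵗ_ : (s t : Term) → Dec (s ≡ t)
  var x    ≟ᵗ var y    = map′ (cong var) (λ { refl → refl }) (x ℕ.≟ y)
  var x    ≟ᵗ fun g us = no λ ()
  fun f ts ≟ᵗ var y    = no λ ()
  fun f ts ≟ᵗ fun g us =
    map′ (λ { (refl , refl) → refl }) (λ { refl → refl , refl }) (f ℕ.≟ g ×-dec ts ≟ᵗˢ us)

  _≟ᵗˢ_ : (ts us : List Term) → Dec (ts ≡ us)
  []       ≟ᵗˢ []       = yes refl
  []       ≟ᵗˢ (_ ∷ _)  = no λ ()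
  (_ ∷ _)  ≟ᵗˢ []       = no λ ()
  (t ∷ ts) ≟ᵗˢ (u ∷ us) =
    map′ (λ { (refl , refl) → refl }) ∷-injective (t ≟ᵗ u ×-dec ts ≟ᵗˢ us)

_≟ᵃ_ : (a b : Atom) → Dec (a ≡ b)
atom p ts ≟ᵃ atom q us =
  map′ (λ { (refl , refl) → refl }) (λ { refl → refl , refl }) (p ℕ.≟ q ×-dec ts ≟ᵗˢ us)

_≟ˡ_ : (K M : Literal) → Dec (K ≡ M)
lit s a ≟ˡ lit t b =
  map′ (λ { (refl , refl) → refl }) (λ { refl → refl , refl }) (s Bool.≟ t ×-dec a ≟ᵃ b)

mutual
  occursT? : ∀ x t → Dec (x occursT t)
  occursT? x (var y)    = x ℕ.≟ y
  occursT? x (fun f ts) = occursTs? x ts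

  occursTs? : ∀ x ts → Dec (x occursTs ts)
  occursTs? x []       = no λ ()
  occursTs? x (t ∷ ts) = occursT? x t ⊎-dec occursTs? x ts

occursC? : ∀ C x → Dec (x occursC C)
occursC? C x =
  map′ find (λ (K , K∈C , o) → lose K∈C o)
    (any? (λ K → occursTs? x (Atom.args (Literal.atm K))) C)

infix 4 _≼_

_≼_ : Subst → Subst → Set
σ ≼ θ = Σ Subst λ τ → θ ≗ τ ∘ˢ σ

MostGeneral : (Subst → Set) → Subst → Set
MostGeneral P σ = P σ × (∀ θ → P θ → σ ≼ θ)

mostGeneral-resp-⇔ : ∀ {P Q σ} → (∀ θ → P θ ⇔ Q θ) → MostGeneral P σ → MostGeneral Q σ
mostGeneral-resp-⇔ P⇔Q (Pσ , general) =
  to (P⇔Q _) Pσ , λ θ Qθ → general θ (from (P⇔Q θ) Qθ)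

Unifier : List Term → List Term → Subst → Set
Unifier ts us σ = substTs σ ts ≡ substTs σ us

Unifiable : List Term → List Term → Set
Unifiable ts us = Σ Subst (Unifier ts us)

record MGU (ts us : List Term) : Set where
  constructor mgu
  field
    unifier     : Subst
    mostGeneral : MostGeneral (Unifier ts us) unifier

mgu-resp-⇔ : ∀ {ts us ts′ us′} → (∀ θ → Unifier ts us θ ⇔ Unifier ts′ us′ θ) → MGU ts us → MGU ts′ us′
mgu-resp-⇔ same (mgu σ σ-mgu) = mgu σ (mostGeneral-resp-⇔ same σ-mgu)

mgu-[] : MGU [] []
mgu-[] = mgu var (refl , λ θ _ → θ , λ x → refl)

mgu-sym : ∀ {ts us} → MGU ts us → MGU us ts
mgu-sym = mgu-resp-⇔ (λ θ → mk⇔ sym sym)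

mgu-∷ : ∀ t {ts us} → MGU ts us → MGU (t ∷ ts) (t ∷ us)
mgu-∷ t = mgu-resp-⇔ (λ θ → mk⇔ (cong (substT θ t ∷_)) (λ eq → proj₂ (∷-injective eq)))

fun-injective : ∀ {f g ts us} → fun f ts ≡ fun g us → f ≡ g × ts ≡ us
fun-injective refl = refl , refl

++-injective : ∀ {A : Set} (xs ys : List A) {zs ws} →
               length xs ≡ length ys → xs ++ zs ≡ ys ++ ws → xs ≡ ys × zs ≡ ws
++-injective []       []       _   eq = refl , eq
++-injective (x ∷ xs) (y ∷ ys) len eq with ∷-injective eq
... | refl , eq′ with ++-injective xs ys (ℕ.suc-injective len) eq′
... | refl , eq″ = refl , eq″

unifier-++⇔fun : ∀ f {as bs ts us} → length as ≡ length bs → ∀ θ →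
                 Unifier (as ++ ts) (bs ++ us) θ ⇔ Unifier (fun f as ∷ ts) (fun f bs ∷ us) θ
unifier-++⇔fun f {as} {bs} {ts} {us} len θ = mk⇔ split join
  where
  join : Unifier (fun f as ∷ ts) (fun f bs ∷ us) θ → Unifier (as ++ ts) (bs ++ us) θ
  join eq with ∷-injective eq
  ... | eq-head , eq-tail = trans (substTs-++ θ as ts)
    (trans (cong₂ _++_ (proj₂ (fun-injective eq-head)) eq-tail) (sym (substTs-++ θ bs us)))

  split : Unifier (as ++ ts) (bs ++ us) θ → Unifier (fun f as ∷ ts) (fun f bs ∷ us) θ
  split eq with ++-injective (substTs θ as) (substTs θ bs)
                  (trans (length-substTs θ as) (trans len (sym (length-substTs θ bs))))
                  (trans (sym (substTs-++ θ as ts)) (trans eq (substTs-++ θ bs us)))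
  ... | eq-args , eq-tail = cong₂ _∷_ (cong (fun f) eq-args) eq-tail

mgu-fun : ∀ f {as bs ts us} → length as ≡ length bs → MGU (as ++ ts) (bs ++ us) →
          MGU (fun f as ∷ ts) (fun f bs ∷ us)
mgu-fun f len = mgu-resp-⇔ (unifier-++⇔fun f len)

unifiable-fun : ∀ {f g as bs ts us} → Unifiable (fun f as ∷ ts) (fun g bs ∷ us) →
                f ≡ g × length as ≡ length bs × Unifiable (as ++ ts) (bs ++ us)
unifiable-fun {as = as} {bs} (θ , eq) with fun-injective (proj₁ (∷-injective eq))
... | refl , eq-args = refl , len , θ , from (unifier-++⇔fun _ len θ) eq
  where
  len : length as ≡ length bs
  len = trans (sym (length-substTs θ as)) (trans (cong length eq-args) (length-substTs θ bs))

_↦_ : ℕ → Term → Subst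
(x ↦ u) y with y ℕ.≟ x
... | yes _ = u
... | no  _ = var y

↦-self : ∀ x u → (x ↦ u) x ≡ u
↦-self x u with x ℕ.≟ x
... | yes _   = refl
... | no  x≢x = contradiction refl x≢x

↦-absorbed : ∀ θ {x u} → θ x ≡ substT θ u → θ ∘ˢ (x ↦ u) ≗ θ
↦-absorbed θ {x} θx≡θu y with y ℕ.≟ x
... | yes refl = sym θx≡θu
... | no  _    = refl

substT-↦-fresh : ∀ {x u} → ¬ x occursT u → substT (x ↦ u) u ≡ u
substT-↦-fresh {x} {u} x∉u = trans (substT-cong u fixes) (substT-var u)
  where
  fixes : ∀ y → y occursT u → (x ↦ u) y ≡ var y
  fixes y y∈u with y ℕ.≟ x
  ... | yes refl = contradiction y∈u x∉u
  ... | no  _    = refl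

occursT-↦ : ∀ {x u y} z → y occursT (x ↦ u) z → y occursT u ⊎ (y ≡ z × z ≢ x)
occursT-↦ {x} z o with z ℕ.≟ x
... | yes _   = inj₁ o
... | no  z≢x = inj₂ (o , z≢x)

unifier-↦ : ∀ {θ x u ts us} → Unifier (var x ∷ ts) (u ∷ us) θ →
            Unifier (substTs (x ↦ u) ts) (substTs (x ↦ u) us) θ
unifier-↦ {θ} {x} {u} {ts} {us} eq = begin
  substTs θ (substTs (x ↦ u) ts) ≡⟨ absorb ts ⟩
  substTs θ ts                   ≡⟨ proj₂ (∷-injective eq) ⟩
  substTs θ us                   ≡⟨ absorb us ⟨
  substTs θ (substTs (x ↦ u) us) ∎
  where
  open ≡-Reasoning
  absorb : ∀ ws → substTs θ (substTs (x ↦ u) ws) ≡ substTs θ ws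
  absorb ws = trans (substTs-∘ˢ θ (x ↦ u) ws) (substTs-≗ (↦-absorbed θ (proj₁ (∷-injective eq))) ws)

mgu-↦ : ∀ {x u ts us} → ¬ x occursT u →
        MGU (substTs (x ↦ u) ts) (substTs (x ↦ u) us) → MGU (var x ∷ ts) (u ∷ us)
mgu-↦ {x} {u} {ts} {us} x∉u (mgu σ (σ-unifies , σ-general)) = mgu (σ ∘ˢ (x ↦ u)) (unifies , general)
  where
  open ≡-Reasoning
  unifies-head : substT σ ((x ↦ u) x) ≡ substT (σ ∘ˢ (x ↦ u)) u
  unifies-head = begin
    substT σ ((x ↦ u) x)       ≡⟨ cong (substT σ) (↦-self x u) ⟩
    substT σ u                 ≡⟨ cong (substT σ) (substT-↦-fresh {x} {u} x∉u) ⟨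
    substT σ (substT (x ↦ u) u) ≡⟨ substT-∘ˢ σ (x ↦ u) u ⟩
    substT (σ ∘ˢ (x ↦ u)) u     ∎

  unifies : Unifier (var x ∷ ts) (u ∷ us) (σ ∘ˢ (x ↦ u))
  unifies = cong₂ _∷_ unifies-head
    (trans (sym (substTs-∘ˢ σ (x ↦ u) ts)) (trans σ-unifies (substTs-∘ˢ σ (x ↦ u) us)))

  general : ∀ θ → Unifier (var x ∷ ts) (u ∷ us) θ → σ ∘ˢ (x ↦ u) ≼ θ
  general θ eq with σ-general θ (unifier-↦ eq)
  ... | τ , θ≗τσ = τ , λ y → begin
    θ y                            ≡⟨ ↦-absorbed θ (proj₁ (∷-injective eq)) y ⟨
    substT θ ((x ↦ u) y)           ≡⟨ substT-≗ θ≗τσ ((x ↦ u) y) ⟩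
    substT (τ ∘ˢ σ) ((x ↦ u) y)    ≡⟨ substT-∘ˢ τ σ ((x ↦ u) y) ⟨
    substT τ (substT σ ((x ↦ u) y)) ∎

Covers : List ℕ → List Term → List Term → Set
Covers V ts us = ∀ y → y occursTs ts ⊎ y occursTs us → y ∈ V

without : ℕ → List ℕ → List ℕ
without x = filter (λ y → ¬? (y ℕ.≟ x))

length-without : ∀ {x} V → x ∈ V → length (without x V) < length V
length-without V x∈V = filter-notAll _ V (lose x∈V (λ x≢x → x≢x refl))

∈-without-↦ : ∀ {V x u y} z → ¬ x occursT u → (y occursT u → y ∈ V) → z ∈ V →
              y occursT (x ↦ u) z → y ∈ without x V
∈-without-↦ z x∉u covers-u z∈V y∈ with occursT-↦ z y∈
... | inj₁ y∈u          = ∈-filter⁺ _ (covers-u y∈u) λ { refl → x∉u y∈u }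
... | inj₂ (refl , z≢x) = ∈-filter⁺ _ z∈V z≢x

covers-↦ : ∀ {V x u ts us} → ¬ x occursT u → Covers V (var x ∷ ts) (u ∷ us) →
           Covers (without x V) (substTs (x ↦ u) ts) (substTs (x ↦ u) us)
covers-↦ {x = x} {u} {ts} {us} x∉u cov y (inj₁ o) =
  let z , z∈ts , y∈ = occursTs-substTs (x ↦ u) ts o
  in ∈-without-↦ z x∉u (cov y ∘ inj₂ ∘ inj₁) (cov z (inj₁ (inj₂ z∈ts))) y∈
covers-↦ {x = x} {u} {ts} {us} x∉u cov y (inj₂ o) =
  let z , z∈us , y∈ = occursTs-substTs (x ↦ u) us o
  in ∈-without-↦ z x∉u (cov y ∘ inj₂ ∘ inj₁) (cov z (inj₂ (inj₂ z∈us))) y∈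

sizes-fun : ∀ {f g} as ts bs us {m} → sizes (fun f as ∷ ts) + sizes (fun g bs ∷ us) ≤ suc m →
            sizes (as ++ ts) + sizes (bs ++ us) ≤ m
sizes-fun as ts bs us sz rewrite sizes-++ as ts | sizes-++ bs us =
  ≤-trans (+-monoʳ-≤ (sizes as + sizes ts) (n≤1+n _)) (s≤s⁻¹ sz)

-- Robinson's algorithm. The recursion is lexicographic: eliminating a variable
-- shortens V (whose length bounds n), every other step keeps V and decreases
-- the total size (bounded by m).
mutual
  mgu-search : ∀ n V → length V ≤ n → ∀ m ts us → sizes ts + sizes us ≤ m →
               Covers V ts us → Unifiable ts us → MGU ts us
  mgu-search n V lv m []       []       _ _ _       = mgu-[]
  mgu-search n V lv m []       (_ ∷ _)  _ _ (_ , ())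
  mgu-search n V lv m (_ ∷ _)  []       _ _ (_ , ())
  mgu-search n V lv m (var x ∷ ts) (u ∷ us) sz cov uni = mgu-var n V lv m x u ts us sz cov uni
  mgu-search n V lv m (fun f as ∷ ts) (var x ∷ us) sz cov (θ , eq) =
    mgu-sym (mgu-var n V lv m x (fun f as) us ts
      (subst (_≤ m) (+-comm (sizes (fun f as ∷ ts)) _) sz)
      (λ { y (inj₁ o) → cov y (inj₂ o) ; y (inj₂ o) → cov y (inj₁ o) })
      (θ , sym eq))
  mgu-search n V lv zero    (fun f as ∷ ts) (fun g bs ∷ us) () cov uni
  mgu-search n V lv (suc m) (fun f as ∷ ts) (fun g bs ∷ us) sz cov uni
    with unifiable-fun uni
  ... | refl , len , uni′ =
    mgu-fun f len (mgu-search n V lv m (as ++ ts) (bs ++ us) (sizes-fun {f} {f} as ts bs us sz) covers uni′)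
    where
    covers : Covers V (as ++ ts) (bs ++ us)
    covers y (inj₁ o) with occursTs-++ as ts o
    ... | inj₁ o′ = cov y (inj₁ (inj₁ o′))
    ... | inj₂ o′ = cov y (inj₁ (inj₂ o′))
    covers y (inj₂ o) with occursTs-++ bs us o
    ... | inj₁ o′ = cov y (inj₂ (inj₁ o′))
    ... | inj₂ o′ = cov y (inj₂ (inj₂ o′))

  mgu-var : ∀ n V → length V ≤ n → ∀ m x u ts us → sizes (var x ∷ ts) + sizes (u ∷ us) ≤ m →
            Covers V (var x ∷ ts) (u ∷ us) → Unifiable (var x ∷ ts) (u ∷ us) → MGU (var x ∷ ts) (u ∷ us)
  mgu-var n V lv zero    x u        ts us () cov uni
  mgu-var n V lv (suc m) x (var y)  ts us sz cov (θ , eq) with x ℕ.≟ y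
  ... | yes refl = mgu-∷ (var x) (mgu-search n V lv m ts us
                     (≤-trans (+-monoʳ-≤ (sizes ts) (n≤1+n _)) (s≤s⁻¹ sz))
                     (λ { y (inj₁ o) → cov y (inj₁ (inj₂ o)) ; y (inj₂ o) → cov y (inj₂ (inj₂ o)) })
                     (θ , proj₂ (∷-injective eq)))
  ... | no x≢y   = mgu-eliminate n V lv x (var y) ts us (λ { refl → x≢y refl }) cov (θ , eq)
  mgu-var n V lv (suc m) x (fun g bs) ts us sz cov (θ , eq) =
    mgu-eliminate n V lv x (fun g bs) ts us (λ o → occurs-check θ o (proj₁ (∷-injective eq))) cov (θ , eq)

  mgu-eliminate : ∀ n V → length V ≤ n → ∀ x u ts us → ¬ x occursT u →
                  Covers V (var x ∷ ts) (u ∷ us) → Unifiable (var x ∷ ts) (u ∷ us) → MGU (var x ∷ ts) (u ∷ us)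
  mgu-eliminate zero V lv x u ts us x∉u cov uni =
    ⊥-elim (n≮0 (<-≤-trans (length-without V (cov x (inj₁ (inj₁ refl)))) lv))
  mgu-eliminate (suc n) V lv x u ts us x∉u cov (θ , eq) =
    mgu-↦ x∉u (mgu-search n (without x V)
      (s≤s⁻¹ (≤-trans (length-without V (cov x (inj₁ (inj₁ refl)))) lv))
      _ (substTs (x ↦ u) ts) (substTs (x ↦ u) us) ≤-refl
      (covers-↦ x∉u cov) (θ , unifier-↦ eq))

unifiable⇒mgu : ∀ ts us → Unifiable ts us → MGU ts us
unifiable⇒mgu ts us = mgu-search _ (varsTs ts ++ varsTs us) ≤-refl _ ts us ≤-refl covers
  where
  covers : Covers (varsTs ts ++ varsTs us) ts us
  covers y (inj₁ o) = ∈-++⁺ˡ (occursTs⇒∈varsTs ts o)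
  covers y (inj₂ o) = ∈-++⁺ʳ (varsTs ts) (occursTs⇒∈varsTs us o)

-- Unification of literals is reduced to that of terms by coding
-- lit s (atom p ts) as the term p(c_s, ts) with a constant c_s for the sign.
signTerm : Bool → Term
signTerm true  = fun 1 []
signTerm false = fun 0 []

literalTerm : Literal → Term
literalTerm (lit s (atom p ts)) = fun p (signTerm s ∷ ts)

substT-literalTerm : ∀ σ K → substT σ (literalTerm K) ≡ literalTerm (substL σ K)
substT-literalTerm σ (lit true  _) = refl
substT-literalTerm σ (lit false _) = refl

literalTerm-injective : ∀ {K M} → literalTerm K ≡ literalTerm M → K ≡ M
literalTerm-injective {lit true  _} {lit true  _} refl = refl
literalTerm-injective {lit false _} {lit false _} refl = refl

unifies⇔unifier : ∀ L Ns θ →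
  Unifies θ L Ns ⇔ Unifier (map (literalTerm ∘ compl) Ns) (map (λ _ → literalTerm L) Ns) θ
unifies⇔unifier L Ns θ = mk⇔ (to′ Ns) (from′ Ns)
  where
  coded : ∀ N → substL θ (compl N) ≡ substL θ L ⇔ substT θ (literalTerm (compl N)) ≡ substT θ (literalTerm L)
  coded N = mk⇔
    (λ eq → trans (substT-literalTerm θ (compl N)) (trans (cong literalTerm eq) (sym (substT-literalTerm θ L))))
    (λ eq → literalTerm-injective
      (trans (sym (substT-literalTerm θ (compl N))) (trans eq (substT-literalTerm θ L))))

  to′ : ∀ Ns → Unifies θ L Ns → Unifier (map (literalTerm ∘ compl) Ns) (map (λ _ → literalTerm L) Ns) θ
  to′ []       []         = refl
  to′ (N ∷ Ns) (eq ∷ eqs) = cong₂ _∷_ (to (coded N) eq) (to′ Ns eqs)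

  from′ : ∀ Ns → Unifier (map (literalTerm ∘ compl) Ns) (map (λ _ → literalTerm L) Ns) θ → Unifies θ L Ns
  from′ []       _  = []
  from′ (N ∷ Ns) eq = from (coded N) (proj₁ (∷-injective eq)) ∷ from′ Ns (proj₂ (∷-injective eq))

unifies⇒mgu : ∀ {ρ L Ns} → Unifies ρ L Ns → Σ Subst λ θ → IsMGU θ L Ns
unifies⇒mgu {ρ} {L} {Ns} ρ-unifies with unifiable⇒mgu _ _ (ρ , to (unifies⇔unifier L Ns ρ) ρ-unifies)
... | mgu θ θ-mgu = θ , mostGeneral-resp-⇔ (λ θ′ → ⇔.sym (unifies⇔unifier L Ns θ′)) θ-mgu

compl-involutive : ∀ K → compl (compl K) ≡ K
compl-involutive (lit s a) = cong (λ b → lit b a) (Bool.not-involutive s)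

substL-cong : ∀ {σ θ} K → (∀ x → x occursTs Atom.args (Literal.atm K) → σ x ≡ θ x) → substL σ K ≡ substL θ K
substL-cong (lit s (atom p ts)) agree = cong (λ us → lit s (atom p us)) (substTs-cong ts agree)

substL-∘ˢ : ∀ υ θ K → substL υ (substL θ K) ≡ substL (υ ∘ˢ θ) K
substL-∘ˢ υ θ (lit s (atom p ts)) = cong (λ us → lit s (atom p us)) (substTs-∘ˢ υ θ ts)

substC-∘ˢ : ∀ {υ θ ρ} → υ ∘ˢ θ ≗ ρ → ∀ C → substC υ (substC θ C) ≡ substC ρ C
substC-∘ˢ {υ} {θ} {ρ} υθ≗ρ C = trans (sym (map-∘ C)) (map-cong composite C)
  where
  composite : ∀ K → substL υ (substL θ K) ≡ substL ρ K
  composite K = trans (substL-∘ˢ υ θ K) (substL-cong K (λ x _ → υθ≗ρ x))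

combine : Clause → Subst → Subst → Subst
combine C σ τ x with occursC? C x
... | yes _ = σ x
... | no  _ = τ x

combine-on-C : ∀ {C σ τ K} → K ∈ C → substL (combine C σ τ) K ≡ substL σ K
combine-on-C {C} {K = K} K∈C = substL-cong K agree
  where
  agree : ∀ x → x occursTs Atom.args (Literal.atm K) → combine C _ _ x ≡ _
  agree x o with occursC? C x
  ... | yes _  = refl
  ... | no  ¬o = contradiction (K , K∈C , o) ¬o

combine-on-D : ∀ {C D σ τ K} → VarDisjoint C D → K ∈ D → substL (combine C σ τ) K ≡ substL τ K
combine-on-D {C} {K = K} C⊥D K∈D = substL-cong K agree
  where
  agree : ∀ x → x occursTs Atom.args (Literal.atm K) → combine C _ _ x ≡ _
  agree x o with occursC? C x
  ... | yes oC = contradiction (K , K∈D , o) (C⊥D x oC)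
  ... | no  _  = refl

∈⇒↭∷ : ∀ {A : Set} {x : A} {xs} → x ∈ xs → ∃ λ ys → xs ↭ x ∷ ys
∈⇒↭∷ x∈xs with ∈-∃++ x∈xs
... | ys , zs , refl = ys ++ zs , shift _ ys zs

↭-filter-∁ : ∀ {A : Set} {P : A → Set} (P? : Decidable P) xs → xs ↭ filter P? xs ++ filter (∁? P?) xs
↭-filter-∁ {A} P? xs = subst (λ (ys , zs) → xs ↭ ys ++ zs) (partition-defn P? xs)
  (↭ₛ⇒↭ (Permutationₛ.partition-↭ (setoid A) P? xs))

-- The resolvent is taken on all literals of D that τ sends to the complement
-- of Lσ, not just on one of them, so that Rυ avoids that complement entirely.
LiftedResolvent : Literal → Clause → Clause → Subst → Subst → Set
LiftedResolvent L C D σ τ = Σ Clause λ R → IsLResolvent L C D R × Σ Subst λ υ →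
  ∀ Z → Z ∈ substC υ R → Z ∈ substC σ C ⊎ (Z ∈ substC τ D × Z ≢ compl (substL σ L))

lift-clash : ∀ {C D L} → VarDisjoint C D → L ∈ C → ∀ σ τ → compl (substL σ L) ∈ substC τ D →
             LiftedResolvent L C D σ τ
lift-clash {C} {D} {L} C⊥D L∈C σ τ clash∈
  with ∈-map⁻ (substL τ) clash∈ | ∈⇒↭∷ L∈C
... | N , N∈D , clashN | C′ , C↭ with ∈⇒↭∷ N∈D
... | D₀ , D↭N∷D₀ =
  R , resolvent C′ Ns D′ N θ C⊥D C↭ D↭ θ-mgu refl , υ , origin
  where
  clashes? : Decidable (λ X → substL τ X ≡ compl (substL σ L))
  clashes? X = substL τ X ≟ˡ compl (substL σ L)

  Ns D′ : Clause
  Ns = filter clashes? D₀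
  D′ = filter (∁? clashes?) D₀

  D↭ : D ↭ (N ∷ Ns) ++ D′
  D↭ = ↭-trans D↭N∷D₀ (prep N (↭-filter-∁ clashes? D₀))

  ∈D₀⇒∈D : ∀ {X} → X ∈ D₀ → X ∈ D
  ∈D₀⇒∈D X∈ = ∈-resp-↭ (↭-sym D↭N∷D₀) (there X∈)

  ρ : Subst
  ρ = combine C σ τ

  ρ-unifies : Unifies ρ L (N ∷ Ns)
  ρ-unifies = tabulate λ {X} X∈ → unify X (clashing X X∈)
    where
    clashing : ∀ X → X ∈ N ∷ Ns → X ∈ D × substL τ X ≡ compl (substL σ L)
    clashing X (here refl) = N∈D , sym clashN
    clashing X (there X∈)  = let X∈D₀ , clashX = ∈-filter⁻ clashes? X∈ in ∈D₀⇒∈D X∈D₀ , clashX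

    unify : ∀ X → X ∈ D × substL τ X ≡ compl (substL σ L) → substL ρ (compl X) ≡ substL ρ L
    unify (lit s a) (X∈D , clashX) = begin
      substL ρ (compl (lit s a))     ≡⟨⟩
      compl (substL ρ (lit s a))     ≡⟨ cong compl (combine-on-D C⊥D X∈D) ⟩
      compl (substL τ (lit s a))     ≡⟨ cong compl clashX ⟩
      compl (compl (substL σ L))     ≡⟨ compl-involutive (substL σ L) ⟩
      substL σ L                     ≡⟨ combine-on-C L∈C ⟨
      substL ρ L                     ∎
      where open ≡-Reasoning

  θ : Subst
  θ = proj₁ (unifies⇒mgu ρ-unifies)

  θ-mgu : IsMGU θ L (N ∷ Ns)
  θ-mgu = proj₂ (unifies⇒mgu ρ-unifies)

  υ : Subst
  υ = proj₁ (proj₂ θ-mgu ρ ρ-unifies)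

  ρ≗υθ : ρ ≗ υ ∘ˢ θ
  ρ≗υθ = proj₂ (proj₂ θ-mgu ρ ρ-unifies)

  R : Clause
  R = substC θ C′ ++ substC θ D′

  Rυ≡ : substC υ R ≡ substC ρ C′ ++ substC ρ D′
  Rυ≡ = trans (map-++ (substL υ) (substC θ C′) _)
          (cong₂ _++_ (substC-∘ˢ (sym ∘ ρ≗υθ) C′) (substC-∘ˢ (sym ∘ ρ≗υθ) D′))

  origin : ∀ Z → Z ∈ substC υ R → Z ∈ substC σ C ⊎ (Z ∈ substC τ D × Z ≢ compl (substL σ L))
  origin Z Z∈ = [ from-C′ , from-D′ ]′ (∈-++⁻ (substC ρ C′) (subst (Z ∈_) Rυ≡ Z∈))
    where
    from-C′ : Z ∈ substC ρ C′ → Z ∈ substC σ C ⊎ (Z ∈ substC τ D × Z ≢ compl (substL σ L))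
    from-C′ Z∈C′ρ =
      let X , X∈C′ , Z≡ = ∈-map⁻ (substL ρ) Z∈C′ρ
          X∈C = ∈-resp-↭ (↭-sym C↭) (there X∈C′)
      in inj₁ (subst (_∈ substC σ C) (sym (trans Z≡ (combine-on-C X∈C))) (∈-map⁺ (substL σ) X∈C))

    from-D′ : Z ∈ substC ρ D′ → Z ∈ substC σ C ⊎ (Z ∈ substC τ D × Z ≢ compl (substL σ L))
    from-D′ Z∈D′ρ =
      let X , X∈D′ , Z≡ = ∈-map⁻ (substL ρ) Z∈D′ρ
          X∈D₀ , ¬clashX = ∈-filter⁻ (∁? clashes?) X∈D′
          Z≡Xτ = trans Z≡ (combine-on-D C⊥D (∈D₀⇒∈D X∈D₀))
      in inj₂ ( subst (_∈ substC τ D) (sym Z≡Xτ) (∈-map⁺ (substL τ) (∈D₀⇒∈D X∈D₀))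
              , subst (_≢ compl (substL σ L)) (sym Z≡Xτ) ¬clashX )

Falsifies : Assignment → Clause → Set
Falsifies J C = ∀ K → K ∈ C → ¬ SatLit J K

satLit? : ∀ J K → Dec (SatLit J K)
satLit? J K = J (Literal.atm K) Bool.≟ Literal.sign K

satClause? : ∀ J C → Dec (SatClause J C)
satClause? J C = map′ find (λ (K , K∈C , sat) → lose K∈C sat) (any? (satLit? J) C)

¬satClause⇒falsifies : ∀ {J C} → ¬ SatClause J C → Falsifies J C
¬satClause⇒falsifies unsat K K∈C sat = unsat (K , K∈C , sat)

valid⇒¬falsifies-instance : ∀ {J R} υ → Valid R → ¬ Falsifies J (substC υ R)
valid⇒¬falsifies-instance {J} υ (K , K∈R , K̄∈R) falsified =
  falsified (compl (substL υ K)) (∈-map⁺ (substL υ) K̄∈R)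
    (Bool.¬-not (falsified (substL υ K) (∈-map⁺ (substL υ) K∈R)))

makeTrue : Assignment → Literal → Assignment
makeTrue J K a with a ≟ᵃ Literal.atm K
... | yes _ = Literal.sign K
... | no  _ = J a

makeTrue-satisfies : ∀ J K → SatLit (makeTrue J K) K
makeTrue-satisfies J K with Literal.atm K ≟ᵃ Literal.atm K
... | yes _   = refl
... | no  a≢a = contradiction refl a≢a

makeTrue-preserves-sign : ∀ J {K X} → SatLit J X → Literal.sign X ≡ Literal.sign K → SatLit (makeTrue J K) X
makeTrue-preserves-sign J {K} {X} sat same-sign with Literal.atm X ≟ᵃ Literal.atm K
... | yes _ = sym same-sign
... | no  _ = sat

makeTrue-falsifies⇒compl : ∀ J {K X} → SatLit J X → ¬ SatLit (makeTrue J K) X → X ≡ compl K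
makeTrue-falsifies⇒compl J {K} {X} sat unsat with Literal.atm X ≟ᵃ Literal.atm K
... | yes same-atom = cong₂ lit (Bool.¬-not (unsat ∘ sym)) same-atom
... | no  _         = contradiction sat unsat

blocked-makeTrue-preserves : ∀ {F C L} → PairwiseVarDisjoint F → C ∈ F → BlockedBy L C F →
  ∀ J σ → Falsifies J (substC σ C) → ∀ {D} τ → D ∈ F ∖ C → SatClause J (substC τ D) →
  SatClause (makeTrue J (substL σ L)) (substC τ D)
blocked-makeTrue-preserves {F} {C} {L} pvd C∈F (L∈C , blocked) J σ Cσ-false {D} τ (D∈F , D≁C) (K , K∈ , satK) =
  decidable-stable (satClause? (makeTrue J (substL σ L)) (substC τ D)) refute
  where
  refute : ¬ ¬ SatClause (makeTrue J (substL σ L)) (substC τ D)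
  refute unsat = absurd (lift-clash (pvd C D C∈F D∈F (D≁C ∘ ↭-sym)) L∈C σ τ clash)
    where
    clash : compl (substL σ L) ∈ substC τ D
    clash = subst (_∈ substC τ D) (makeTrue-falsifies⇒compl J satK (λ sat → unsat (K , K∈ , sat))) K∈

    absurd : ¬ LiftedResolvent L C D σ τ
    absurd (R , resolves , υ , origin) =
      valid⇒¬falsifies-instance υ (blocked D (D∈F , D≁C) R resolves) Rυ-false
      where
      Rυ-false : Falsifies J (substC υ R)
      Rυ-false Z Z∈ with origin Z Z∈
      ... | inj₁ Z∈Cσ        = Cσ-false Z Z∈Cσ
      ... | inj₂ (Z∈Dτ , Z≢) = λ sat → Z≢ (makeTrue-falsifies⇒compl J sat (λ sat′ → unsat (Z , Z∈Dτ , sat′)))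

-- pending contains every σ whose instance of L is false. Flipping never
-- falsifies an instance of L, since all of them carry the sign of L, and it
-- makes Lσ true for a pending σ, so pending shrinks.
repair : ∀ {C L} → L ∈ C → (Inv : Assignment → Set) →
  (∀ J σ → Falsifies J (substC σ C) → Inv J → Inv (makeTrue J (substL σ L))) →
  ∀ σs J → Inv J → Σ Assignment λ J′ → Inv J′ × All (λ σ → SatClause J′ (substC σ C)) σs
repair {C} {L} L∈C Inv step σs J inv = go J σs (<-wellFounded _) inv (λ _ → inj₂)
  where
  go : ∀ J pending → Acc _<_ (length pending) → Inv J →
       (∀ σ → σ ∈ σs → SatLit J (substL σ L) ⊎ σ ∈ pending) →
       Σ Assignment λ J′ → Inv J′ × All (λ σ → SatClause J′ (substC σ C)) σs
  go J pending (acc smaller) inv covered with all? (λ σ → satClause? J (substC σ C)) σs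
  ... | yes done = J , inv , done
  ... | no ¬done with find (¬All⇒Any¬ (λ σ → satClause? J (substC σ C)) σs ¬done)
  ... | σ , σ∈ , unsat = go J′ pending′ (smaller shrinks) (step J σ Cσ-false inv) covered′
    where
    Cσ-false : Falsifies J (substC σ C)
    Cσ-false = ¬satClause⇒falsifies unsat

    J′ : Assignment
    J′ = makeTrue J (substL σ L)

    pending′ : List Subst
    pending′ = filter (λ σ′ → ¬? (satLit? J′ (substL σ′ L))) pending

    σ-pending : σ ∈ pending
    σ-pending with covered σ σ∈
    ... | inj₁ sat = contradiction sat (Cσ-false (substL σ L) (∈-map⁺ (substL σ) L∈C))
    ... | inj₂ σ∈′ = σ∈′

    shrinks : length pending′ < length pending
    shrinks = filter-notAll _ pending (lose σ-pending (λ unsat → unsat (makeTrue-satisfies J (substL σ L))))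

    covered′ : ∀ σ′ → σ′ ∈ σs → SatLit J′ (substL σ′ L) ⊎ σ′ ∈ pending′
    covered′ σ′ σ′∈ with satLit? J′ (substL σ′ L)
    ... | yes sat = inj₁ sat
    ... | no  unsat with covered σ′ σ′∈
    ...   | inj₁ sat = contradiction (makeTrue-preserves-sign J sat refl) unsat
    ...   | inj₂ σ′∈ = inj₂ (∈-filter⁺ _ σ′∈ unsat)

lemma2 : (F : Formula) (C : Clause) →
    PairwiseVarDisjoint F →
    C ∈ F →
    Blocked C F →
    (F' : List Clause) →
    (∀ G → G ∈ F' → Σ Clause λ D → D ∈ F ∖ C × GroundInstanceOf G D) →
    (FC : List Clause) →
    (∀ G → G ∈ FC → GroundInstanceOf G C) →
    ((I : Assignment) → SatSet I F' → Σ Assignment λ I' → SatSet I' (F' ++ FC))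
    × (PropSatisfiable F' → PropSatisfiable (F' ++ FC))
lemma2 F C pvd C∈F (L , blocking) F' F'-instances FC FC-instances =
  extend , λ (I , sat) → extend I sat
  where
  σ-of : ∀ {G} → G ∈ FC → Subst
  σ-of {G} G∈ = proj₁ (FC-instances G G∈)

  preserved : ∀ J σ → Falsifies J (substC σ C) → SatSet J F' → SatSet (makeTrue J (substL σ L)) F'
  preserved J σ Cσ-false satF' = tabulate λ {G} G∈ →
    let D , D∈ , τ , G≡ , _ = F'-instances G G∈ in
    subst (SatClause _) (sym G≡) (blocked-makeTrue-preserves pvd C∈F blocking J σ Cσ-false τ D∈
      (subst (SatClause J) G≡ (lookup satF' G∈)))

  satisfies-FC : ∀ {J} → All (λ σ → SatClause J (substC σ C)) (mapWith∈ FC σ-of) → SatSet J FC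
  satisfies-FC {J} satInstances = tabulate λ {G} G∈ →
    subst (SatClause J) (sym (proj₁ (proj₂ (FC-instances G G∈))))
      (lookup satInstances (mapWith∈⁺ σ-of (G , G∈ , refl)))

  extend : (I : Assignment) → SatSet I F' → Σ Assignment λ I' → SatSet I' (F' ++ FC)
  extend I sat =
    let I' , repaired = repair (proj₁ blocking) (λ J → SatSet J F') preserved (mapWith∈ FC σ-of) I sat
    in I' , ++⁺ (proj₁ repaired) (satisfies-FC (proj₂ repaired))
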